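{- (Strong Normalisation) In the Fitch-style calculus for $IK$: if $\Gamma\vdash t:A$ is derivable, then $t$ is normalisable, i.e. there is an integer bounding the length of every reduction sequence $t\mapsto t_1\mapsto t_2\mapsto\cdots$ starting from $t$.
   Context: Types: $A,B ::= p \mid 1 \mid A\times B \mid A\to B \mid 0 \mid A+B \mid \Box A$ ($p$ atoms). Contexts: $\Gamma ::= \cdot \mid \Gamma,x:A \mid \Gamma,\bullet$ (variables distinct; $\bullet$ is a structural symbol called a lock). Terms: $x$, $\langle\rangle$, $\langle t,u\rangle$, $\pi_1 t$, $\pi_2 t$, $\lambda x.t$, $t\,u$, $\mathrm{inl}\,t$, $\mathrm{inr}\,t$, $\mathrm{case}\ s\ \mathrm{of}\ (x.t;\,y.u)$, $\mathrm{abort}\,t$, $\mathrm{shut}\,t$, $\mathrm{open}\,t$. Typing rules: (var) $\Gamma,x:A,\Gamma'\vdash x:A$ provided $\Gamma'$ contains no lock; (products) $\Gamma\vdash\langle\rangle:1$; from $\Gamma\vdash t:A$, $\Gamma\vdash u:B$ infer $\Gamma\vdash\langle t,u\rangle:A\times B$; from $\Gamma\vdash t:A_1\times A_2$ infer $\Gamma\vdash\pi_i t:A_i$; (functions) from $\Gamma,x:A\vdash t:B$ infer $\Gamma\vdash\lambda x.t:A\to B$; from $\Gamma\vdash t:A\to B$, $\Gamma\vdash u:A$ infer $\Gamma\vdash t\,u:B$; (sums) from $\Gamma\vdash t:A$ infer $\Gamma\vdash\mathrm{inl}\,t:A+B$; symmetrically for $\mathrm{inr}$; from $\Gamma\vdash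 s:A+B$, $\Gamma,x:A,\Gamma'\vdash t:C$, $\Gamma,y:B,\Gamma'\vdash u:C$ infer $\Gamma,\Gamma'\vdash\mathrm{case}\ s\ \mathrm{of}\ (x.t;\,y.u):C$ (any $\Gamma'$); from $\Gamma\vdash t:0$ infer $\Gamma,\Gamma'\vdash\mathrm{abort}\,t:A$ (any $\Gamma'$); (shut) from $\Gamma,\bullet\vdash t:A$ infer $\Gamma\vdash\mathrm{shut}\,t:\Box A$; (open) from $\Gamma\vdash t:\Box A$ infer $\Gamma,\bullet,\Gamma'\vdash\mathrm{open}\,t:A$ provided $\Gamma'$ contains no lock. Reduction: $\mapsto$ is the closure under all term formers of the rules $(\lambda x.t)\,u\mapsto t[u/x]$; $\pi_i\langle t_1,t_2\rangle\mapsto t_i$; $\mathrm{case}\ (\mathrm{inl}\,s)\ \mathrm{of}\ (x.t;\,y.u)\mapsto t[s/x]$; $\mathrm{case}\ (\mathrm{inr}\,s)\ \mathrm{of}\ (x.t;\,y.u)\mapsto u[s/y]$; $\mathrm{open}\,\mathrm{shut}\,t\mapsto t$; and the commuting conversions $E[\mathrm{case}\ s\ \mathrm{of}\ (x.t;\,y.u)]\mapsto\mathrm{case}\ s\ \mathrm{of}\ (x.E[t];\,y.E[u])$ and $E[\mathrm{abort}\,t]\mapsto\mathrm{abort}\,t$ for every elimination frame $E[-]$ among $[-]\,v$, $\pi_1[-]$, $\pi_2[-]$, $\mathrm{case}\ [-]\ \mathrm{of}\ (x'.t';\,y'.u')$, $\mathrm{abort}[-]$, $\mathrm{open}[-]$.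 -}

module Defs where

open import Data.Nat using (ℕ; zero; suc; _+_; _<_; _≤_; _<ᵇ_)
open import Data.Bool using (true; false; if_then_else_)
open import Data.Product using (Σ)

data Ty : Set where
  atom : ℕ → Ty
  𝟙    : Ty
  _⊗_  : Ty → Ty → Ty
  _⇒_  : Ty → Ty → Ty
  𝟘    : Ty
  _⊕_  : Ty → Ty → Ty
  □_   : Ty → Ty

data Ctx : Set where
  ε     : Ctx
  _,∶_  : Ctx → Ty → Ctx
  _,🔒  : Ctx → Ctx

infixl 5 _,∶_ _,🔒 _++_

_++_ : Ctx → Ctx → Ctx
Γ ++ ε          = Γ
Γ ++ (Δ ,∶ A)   = (Γ ++ Δ) ,∶ A
Γ ++ (Δ ,🔒)    = (Γ ++ Δ) ,🔒

data LockFree : Ctx → Set where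
  ε  : LockFree ε
  _,∶_ : ∀ {Δ} → LockFree Δ → (A : Ty) → LockFree (Δ ,∶ A)

nvars : Ctx → ℕ
nvars ε        = 0
nvars (Δ ,∶ _) = suc (nvars Δ)
nvars (Δ ,🔒)  = nvars Δ

-- Raw terms, de Bruijn indices (counting variables only; locks are
-- not binders).  lam binds index 0 in its body; case binds index 0 in
-- each branch.

data Tm : Set where
  var   : ℕ → Tm
  ⟨⟩    : Tm
  ⟨_,_⟩ : Tm → Tm → Tm
  π₁ π₂ : Tm → Tm
  lam   : Tm → Tm
  _·_   : Tm → Tm → Tm
  inl inr : Tm → Tm
  case  : Tm → Tm → Tm → Tm
  abort : Tm → Tm
  shut  : Tm → Tm
  open' : Tm → Tm

infixl 7 _·_

ext : (ℕ → ℕ) → ℕ → ℕ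
ext ρ zero    = zero
ext ρ (suc i) = suc (ρ i)

ren : (ℕ → ℕ) → Tm → Tm
ren ρ (var i)      = var (ρ i)
ren ρ ⟨⟩           = ⟨⟩
ren ρ ⟨ t , u ⟩    = ⟨ ren ρ t , ren ρ u ⟩
ren ρ (π₁ t)       = π₁ (ren ρ t)
ren ρ (π₂ t)       = π₂ (ren ρ t)
ren ρ (lam t)      = lam (ren (ext ρ) t)
ren ρ (t · u)      = ren ρ t · ren ρ u
ren ρ (inl t)      = inl (ren ρ t)
ren ρ (inr t)      = inr (ren ρ t)
ren ρ (case s t u) = case (ren ρ s) (ren (ext ρ) t) (ren (ext ρ) u)
ren ρ (abort t)    = abort (ren ρ t)
ren ρ (shut t)     = shut (ren ρ t)
ren ρ (open' t)    = open' (ren ρ t)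

exts : (ℕ → Tm) → ℕ → Tm
exts σ zero    = var zero
exts σ (suc i) = ren suc (σ i)

sub : (ℕ → Tm) → Tm → Tm
sub σ (var i)      = σ i
sub σ ⟨⟩           = ⟨⟩
sub σ ⟨ t , u ⟩    = ⟨ sub σ t , sub σ u ⟩
sub σ (π₁ t)       = π₁ (sub σ t)
sub σ (π₂ t)       = π₂ (sub σ t)
sub σ (lam t)      = lam (sub (exts σ) t)
sub σ (t · u)      = sub σ t · sub σ u
sub σ (inl t)      = inl (sub σ t)
sub σ (inr t)      = inr (sub σ t)
sub σ (case s t u) = case (sub σ s) (sub (exts σ) t) (sub (exts σ) u)
sub σ (abort t)    = abort (sub σ t)
sub σ (shut t)     = shut (sub σ t)
sub σ (open' t)    = open' (sub σ t)

_[_/0] : Tm → Tm → Tm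
t [ u /0] = sub σ t
  where
  σ : ℕ → Tm
  σ zero    = u
  σ (suc i) = var i

wkn : ℕ → Tm → Tm
wkn k = ren (k +_)

-- A body typed in Γ , x:A , Γ' (x has index k = nvars Γ') is turned into
-- the raw branch of a case, which binds x at index 0 (over Γ , Γ').
mvIdx : ℕ → ℕ → ℕ
mvIdx k i = if i <ᵇ k then suc i else (if k <ᵇ i then i else zero)

mv : ℕ → Tm → Tm
mv k = ren (mvIdx k)

infix 4 _⊢_∶_

data _⊢_∶_ : Ctx → Tm → Ty → Set where
  ⊢var  : ∀ {Γ Γ' A} → LockFree Γ' →
          (Γ ,∶ A) ++ Γ' ⊢ var (nvars Γ') ∶ A
  ⊢unit : ∀ {Γ} → Γ ⊢ ⟨⟩ ∶ 𝟙
  ⊢pair : ∀ {Γ t u A B} → Γ ⊢ t ∶ A → Γ ⊢ u ∶ B → Γ ⊢ ⟨ t , u ⟩ ∶ A ⊗ B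
  ⊢π₁   : ∀ {Γ t A B} → Γ ⊢ t ∶ A ⊗ B → Γ ⊢ π₁ t ∶ A
  ⊢π₂   : ∀ {Γ t A B} → Γ ⊢ t ∶ A ⊗ B → Γ ⊢ π₂ t ∶ B
  ⊢lam  : ∀ {Γ t A B} → Γ ,∶ A ⊢ t ∶ B → Γ ⊢ lam t ∶ A ⇒ B
  ⊢app  : ∀ {Γ t u A B} → Γ ⊢ t ∶ A ⇒ B → Γ ⊢ u ∶ A → Γ ⊢ t · u ∶ B
  ⊢inl  : ∀ {Γ t A B} → Γ ⊢ t ∶ A → Γ ⊢ inl t ∶ A ⊕ B
  ⊢inr  : ∀ {Γ t A B} → Γ ⊢ t ∶ B → Γ ⊢ inr t ∶ A ⊕ B
  ⊢case : ∀ {Γ Γ' s t u A B C} → Γ ⊢ s ∶ A ⊕ B →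
          (Γ ,∶ A) ++ Γ' ⊢ t ∶ C → (Γ ,∶ B) ++ Γ' ⊢ u ∶ C →
          Γ ++ Γ' ⊢ case (wkn (nvars Γ') s) (mv (nvars Γ') t) (mv (nvars Γ') u) ∶ C
  ⊢abort : ∀ {Γ Γ' t A} → Γ ⊢ t ∶ 𝟘 → Γ ++ Γ' ⊢ abort (wkn (nvars Γ') t) ∶ A
  ⊢shut : ∀ {Γ t A} → Γ ,🔒 ⊢ t ∶ A → Γ ⊢ shut t ∶ □ A
  ⊢open : ∀ {Γ Γ' t A} → LockFree Γ' → Γ ⊢ t ∶ □ A →
          (Γ ,🔒) ++ Γ' ⊢ open' (wkn (nvars Γ') t) ∶ A

data Frame : Set where
  app[-]   : Tm → Frame
  π₁[-]    : Frame
  π₂[-]    : Frame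
  case[-]  : Tm → Tm → Frame
  abort[-] : Frame
  open[-]  : Frame

plug : Frame → Tm → Tm
plug (app[-] v)     t = t · v
plug π₁[-]          t = π₁ t
plug π₂[-]          t = π₂ t
plug (case[-] t' u') t = case t t' u'
plug abort[-]       t = abort t
plug open[-]        t = open' t

wkF : Frame → Frame
wkF (app[-] v)      = app[-] (ren suc v)
wkF π₁[-]           = π₁[-]
wkF π₂[-]           = π₂[-]
wkF (case[-] t' u') = case[-] (ren (ext suc) t') (ren (ext suc) u')
wkF abort[-]        = abort[-]
wkF open[-]         = open[-]

infix 4 _↦_

data _↦_ : Tm → Tm → Set where
  β⇒     : ∀ {t u} → lam t · u ↦ t [ u /0]
  β⊗₁    : ∀ {t u} → π₁ ⟨ t , u ⟩ ↦ t
  β⊗₂    : ∀ {t u} → π₂ ⟨ t , u ⟩ ↦ u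
  β⊕₁    : ∀ {s t u} → case (inl s) t u ↦ t [ s /0]
  β⊕₂    : ∀ {s t u} → case (inr s) t u ↦ u [ s /0]
  β□     : ∀ {t} → open' (shut t) ↦ t
  κcase  : ∀ {E s t u} → plug E (case s t u) ↦ case s (plug (wkF E) t) (plug (wkF E) u)
  κabort : ∀ {E t} → plug E (abort t) ↦ abort t
  ξpair₁ : ∀ {t t' u} → t ↦ t' → ⟨ t , u ⟩ ↦ ⟨ t' , u ⟩
  ξpair₂ : ∀ {t u u'} → u ↦ u' → ⟨ t , u ⟩ ↦ ⟨ t , u' ⟩
  ξπ₁    : ∀ {t t'} → t ↦ t' → π₁ t ↦ π₁ t'
  ξπ₂    : ∀ {t t'} → t ↦ t' → π₂ t ↦ π₂ t'
  ξlam   : ∀ {t t'} → t ↦ t' → lam t ↦ lam t'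
  ξapp₁  : ∀ {t t' u} → t ↦ t' → t · u ↦ t' · u
  ξapp₂  : ∀ {t u u'} → u ↦ u' → t · u ↦ t · u'
  ξinl   : ∀ {t t'} → t ↦ t' → inl t ↦ inl t'
  ξinr   : ∀ {t t'} → t ↦ t' → inr t ↦ inr t'
  ξcase₁ : ∀ {s s' t u} → s ↦ s' → case s t u ↦ case s' t u
  ξcase₂ : ∀ {s t t' u} → t ↦ t' → case s t u ↦ case s t' u
  ξcase₃ : ∀ {s t u u'} → u ↦ u' → case s t u ↦ case s t u'
  ξabort : ∀ {t t'} → t ↦ t' → abort t ↦ abort t'
  ξshut  : ∀ {t t'} → t ↦ t' → shut t ↦ shut t'
  ξopen  : ∀ {t t'} → t ↦ t' → open' t ↦ open' t'

data RedSeq : ℕ → Tm → Set where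
  done : ∀ {t} → RedSeq zero t
  step : ∀ {m t t'} → t ↦ t' → RedSeq m t' → RedSeq (suc m) t

Normalisable : Tm → Set
Normalisable t = Σ ℕ λ n → ∀ m → RedSeq m t → m ≤ n

-- Strong normalisation by reducibility in the style of ⊤⊤-lifting. A term of type A is
-- reducible when it is strongly normalising inside every reducible stack of eliminations for A;
-- for the positive types 𝟘 and A ⊕ B the reducible stacks are those that make every reducible
-- canonical form (a variable, resp. an injection of a reducible term) strongly normalising.
-- Commuting conversions then merely rearrange the stack, and are absorbed by an induction on
-- its length. The fundamental
-- lemma yields strong normalisation of typed terms, and as reduction is finitely branching the
-- height of the reduction tree bounds the length of every reduction sequence.
module Submission where

open import Data.Bool using (true; false)
open import Data.Empty using (⊥-elim)
open import Data.List as List using (List; []; _∷_; length) renaming (_++_ to _++ᴸ_)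
open import Data.List.Extrema.Nat using (max; v≤max⁺)
open import Data.List.Relation.Unary.Any as Any using (Any; here)
open import Data.List.Relation.Unary.Any.Properties using (map⁺; ++⁺ˡ; ++⁺ʳ)
open import Data.Nat using (ℕ; zero; suc; _+_; _≤_; z≤n; s≤s; _<ᵇ_)
open import Data.Nat.Properties using (≤-refl; ≤-trans; n≤1+n)
open import Data.Product as Product using (Σ; _×_; _,_; proj₁; proj₂; map₂)
open import Data.Sum using (inj₂)
open import Function using (_∘_; flip)
open import Induction.WellFounded using (Acc; acc; acc-inverse)
open import Relation.Binary.PropositionalEquality
  using (_≡_; refl; sym; trans; cong; cong₂; subst; subst₂; _≗_)
open import Relation.Nullary using (¬_)

open import Defs

cong₃ : ∀ {A B C D : Set} (f : A → B → C → D) {a a' b b' c c'} →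
        a ≡ a' → b ≡ b' → c ≡ c' → f a b c ≡ f a' b' c'
cong₃ f refl refl refl = refl

ext-cong : ∀ {ρ ρ'} → ρ ≗ ρ' → ext ρ ≗ ext ρ'
ext-cong e zero    = refl
ext-cong e (suc i) = cong suc (e i)

ren-cong : ∀ {ρ ρ'} → ρ ≗ ρ' → ∀ t → ren ρ t ≡ ren ρ' t
ren-cong e (var i)      = cong var (e i)
ren-cong e ⟨⟩           = refl
ren-cong e ⟨ t , u ⟩    = cong₂ ⟨_,_⟩ (ren-cong e t) (ren-cong e u)
ren-cong e (π₁ t)       = cong π₁ (ren-cong e t)
ren-cong e (π₂ t)       = cong π₂ (ren-cong e t)
ren-cong e (lam t)      = cong lam (ren-cong (ext-cong e) t)
ren-cong e (t · u)      = cong₂ _·_ (ren-cong e t) (ren-cong e u)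
ren-cong e (inl t)      = cong inl (ren-cong e t)
ren-cong e (inr t)      = cong inr (ren-cong e t)
ren-cong e (case s t u) = cong₃ case (ren-cong e s) (ren-cong (ext-cong e) t) (ren-cong (ext-cong e) u)
ren-cong e (abort t)    = cong abort (ren-cong e t)
ren-cong e (shut t)     = cong shut (ren-cong e t)
ren-cong e (open' t)    = cong open' (ren-cong e t)

exts-cong : ∀ {σ σ'} → σ ≗ σ' → exts σ ≗ exts σ'
exts-cong e zero    = refl
exts-cong e (suc i) = cong (ren suc) (e i)

sub-cong : ∀ {σ σ'} → σ ≗ σ' → ∀ t → sub σ t ≡ sub σ' t
sub-cong e (var i)      = e i
sub-cong e ⟨⟩           = refl
sub-cong e ⟨ t , u ⟩    = cong₂ ⟨_,_⟩ (sub-cong e t) (sub-cong e u)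
sub-cong e (π₁ t)       = cong π₁ (sub-cong e t)
sub-cong e (π₂ t)       = cong π₂ (sub-cong e t)
sub-cong e (lam t)      = cong lam (sub-cong (exts-cong e) t)
sub-cong e (t · u)      = cong₂ _·_ (sub-cong e t) (sub-cong e u)
sub-cong e (inl t)      = cong inl (sub-cong e t)
sub-cong e (inr t)      = cong inr (sub-cong e t)
sub-cong e (case s t u) = cong₃ case (sub-cong e s) (sub-cong (exts-cong e) t) (sub-cong (exts-cong e) u)
sub-cong e (abort t)    = cong abort (sub-cong e t)
sub-cong e (shut t)     = cong shut (sub-cong e t)
sub-cong e (open' t)    = cong open' (sub-cong e t)

ext-∘ : ∀ ρ ρ' → ext ρ ∘ ext ρ' ≗ ext (ρ ∘ ρ')
ext-∘ ρ ρ' zero    = refl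
ext-∘ ρ ρ' (suc i) = refl

ren-ren : ∀ ρ ρ' t → ren ρ (ren ρ' t) ≡ ren (ρ ∘ ρ') t
ren-ren ρ ρ' (var i)      = refl
ren-ren ρ ρ' ⟨⟩           = refl
ren-ren ρ ρ' ⟨ t , u ⟩    = cong₂ ⟨_,_⟩ (ren-ren ρ ρ' t) (ren-ren ρ ρ' u)
ren-ren ρ ρ' (π₁ t)       = cong π₁ (ren-ren ρ ρ' t)
ren-ren ρ ρ' (π₂ t)       = cong π₂ (ren-ren ρ ρ' t)
ren-ren ρ ρ' (lam t)      = cong lam (trans (ren-ren _ _ t) (ren-cong (ext-∘ ρ ρ') t))
ren-ren ρ ρ' (t · u)      = cong₂ _·_ (ren-ren ρ ρ' t) (ren-ren ρ ρ' u)
ren-ren ρ ρ' (inl t)      = cong inl (ren-ren ρ ρ' t)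
ren-ren ρ ρ' (inr t)      = cong inr (ren-ren ρ ρ' t)
ren-ren ρ ρ' (case s t u) = cong₃ case (ren-ren ρ ρ' s)
  (trans (ren-ren _ _ t) (ren-cong (ext-∘ ρ ρ') t)) (trans (ren-ren _ _ u) (ren-cong (ext-∘ ρ ρ') u))
ren-ren ρ ρ' (abort t)    = cong abort (ren-ren ρ ρ' t)
ren-ren ρ ρ' (shut t)     = cong shut (ren-ren ρ ρ' t)
ren-ren ρ ρ' (open' t)    = cong open' (ren-ren ρ ρ' t)

exts-∘-ext : ∀ σ ρ → exts σ ∘ ext ρ ≗ exts (σ ∘ ρ)
exts-∘-ext σ ρ zero    = refl
exts-∘-ext σ ρ (suc i) = refl

sub-ren : ∀ σ ρ t → sub σ (ren ρ t) ≡ sub (σ ∘ ρ) t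
sub-ren σ ρ (var i)      = refl
sub-ren σ ρ ⟨⟩           = refl
sub-ren σ ρ ⟨ t , u ⟩    = cong₂ ⟨_,_⟩ (sub-ren σ ρ t) (sub-ren σ ρ u)
sub-ren σ ρ (π₁ t)       = cong π₁ (sub-ren σ ρ t)
sub-ren σ ρ (π₂ t)       = cong π₂ (sub-ren σ ρ t)
sub-ren σ ρ (lam t)      = cong lam (trans (sub-ren _ _ t) (sub-cong (exts-∘-ext σ ρ) t))
sub-ren σ ρ (t · u)      = cong₂ _·_ (sub-ren σ ρ t) (sub-ren σ ρ u)
sub-ren σ ρ (inl t)      = cong inl (sub-ren σ ρ t)
sub-ren σ ρ (inr t)      = cong inr (sub-ren σ ρ t)
sub-ren σ ρ (case s t u) = cong₃ case (sub-ren σ ρ s)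
  (trans (sub-ren _ _ t) (sub-cong (exts-∘-ext σ ρ) t)) (trans (sub-ren _ _ u) (sub-cong (exts-∘-ext σ ρ) u))
sub-ren σ ρ (abort t)    = cong abort (sub-ren σ ρ t)
sub-ren σ ρ (shut t)     = cong shut (sub-ren σ ρ t)
sub-ren σ ρ (open' t)    = cong open' (sub-ren σ ρ t)

ren-ext-∘-exts : ∀ ρ σ → ren (ext ρ) ∘ exts σ ≗ exts (ren ρ ∘ σ)
ren-ext-∘-exts ρ σ zero    = refl
ren-ext-∘-exts ρ σ (suc i) = trans (ren-ren (ext ρ) suc (σ i)) (sym (ren-ren suc ρ (σ i)))

ren-sub : ∀ ρ σ t → ren ρ (sub σ t) ≡ sub (ren ρ ∘ σ) t
ren-sub ρ σ (var i)      = refl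
ren-sub ρ σ ⟨⟩           = refl
ren-sub ρ σ ⟨ t , u ⟩    = cong₂ ⟨_,_⟩ (ren-sub ρ σ t) (ren-sub ρ σ u)
ren-sub ρ σ (π₁ t)       = cong π₁ (ren-sub ρ σ t)
ren-sub ρ σ (π₂ t)       = cong π₂ (ren-sub ρ σ t)
ren-sub ρ σ (lam t)      = cong lam (trans (ren-sub _ _ t) (sub-cong (ren-ext-∘-exts ρ σ) t))
ren-sub ρ σ (t · u)      = cong₂ _·_ (ren-sub ρ σ t) (ren-sub ρ σ u)
ren-sub ρ σ (inl t)      = cong inl (ren-sub ρ σ t)
ren-sub ρ σ (inr t)      = cong inr (ren-sub ρ σ t)
ren-sub ρ σ (case s t u) = cong₃ case (ren-sub ρ σ s)
  (trans (ren-sub _ _ t) (sub-cong (ren-ext-∘-exts ρ σ) t)) (trans (ren-sub _ _ u) (sub-cong (ren-ext-∘-exts ρ σ) u))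
ren-sub ρ σ (abort t)    = cong abort (ren-sub ρ σ t)
ren-sub ρ σ (shut t)     = cong shut (ren-sub ρ σ t)
ren-sub ρ σ (open' t)    = cong open' (ren-sub ρ σ t)

sub-ren-commute : ∀ {τ ρ ρ' σ} → τ ∘ ρ ≗ ren ρ' ∘ σ → ∀ t → sub τ (ren ρ t) ≡ ren ρ' (sub σ t)
sub-ren-commute {τ} {ρ} {ρ'} {σ} e t = trans (sub-ren τ ρ t) (trans (sub-cong e t) (sym (ren-sub ρ' σ t)))

sub-exts-∘-exts : ∀ σ τ → sub (exts σ) ∘ exts τ ≗ exts (sub σ ∘ τ)
sub-exts-∘-exts σ τ zero    = refl
sub-exts-∘-exts σ τ (suc i) = sub-ren-commute (λ _ → refl) (τ i)

sub-sub : ∀ σ τ t → sub σ (sub τ t) ≡ sub (sub σ ∘ τ) t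
sub-sub σ τ (var i)      = refl
sub-sub σ τ ⟨⟩           = refl
sub-sub σ τ ⟨ t , u ⟩    = cong₂ ⟨_,_⟩ (sub-sub σ τ t) (sub-sub σ τ u)
sub-sub σ τ (π₁ t)       = cong π₁ (sub-sub σ τ t)
sub-sub σ τ (π₂ t)       = cong π₂ (sub-sub σ τ t)
sub-sub σ τ (lam t)      = cong lam (trans (sub-sub _ _ t) (sub-cong (sub-exts-∘-exts σ τ) t))
sub-sub σ τ (t · u)      = cong₂ _·_ (sub-sub σ τ t) (sub-sub σ τ u)
sub-sub σ τ (inl t)      = cong inl (sub-sub σ τ t)
sub-sub σ τ (inr t)      = cong inr (sub-sub σ τ t)
sub-sub σ τ (case s t u) = cong₃ case (sub-sub σ τ s)
  (trans (sub-sub _ _ t) (sub-cong (sub-exts-∘-exts σ τ) t)) (trans (sub-sub _ _ u) (sub-cong (sub-exts-∘-exts σ τ) u))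
sub-sub σ τ (abort t)    = cong abort (sub-sub σ τ t)
sub-sub σ τ (shut t)     = cong shut (sub-sub σ τ t)
sub-sub σ τ (open' t)    = cong open' (sub-sub σ τ t)

exts-var : exts var ≗ var
exts-var zero    = refl
exts-var (suc i) = refl

sub-var : ∀ t → sub var t ≡ t
sub-var (var i)      = refl
sub-var ⟨⟩           = refl
sub-var ⟨ t , u ⟩    = cong₂ ⟨_,_⟩ (sub-var t) (sub-var u)
sub-var (π₁ t)       = cong π₁ (sub-var t)
sub-var (π₂ t)       = cong π₂ (sub-var t)
sub-var (lam t)      = cong lam (trans (sub-cong exts-var t) (sub-var t))
sub-var (t · u)      = cong₂ _·_ (sub-var t) (sub-var u)
sub-var (inl t)      = cong inl (sub-var t)
sub-var (inr t)      = cong inr (sub-var t)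
sub-var (case s t u) = cong₃ case (sub-var s)
  (trans (sub-cong exts-var t) (sub-var t)) (trans (sub-cong exts-var u) (sub-var u))
sub-var (abort t)    = cong abort (sub-var t)
sub-var (shut t)     = cong shut (sub-var t)
sub-var (open' t)    = cong open' (sub-var t)

sub-ren-id : ∀ {σ ρ} → σ ∘ ρ ≗ var → ∀ t → sub σ (ren ρ t) ≡ t
sub-ren-id {σ} {ρ} e t = trans (sub-ren σ ρ t) (trans (sub-cong e t) (sub-var t))

infixr 5 _•_

_•_ : Tm → (ℕ → Tm) → ℕ → Tm
(a • σ) zero    = a
(a • σ) (suc i) = σ i

[/0]-as-sub : ∀ t u → t [ u /0] ≡ sub (u • var) t
[/0]-as-sub t u = sub-cong (λ { zero → refl ; (suc i) → refl }) t

sub-exts-[/0] : ∀ σ t a → sub (exts σ) t [ a /0] ≡ sub (a • σ) t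
sub-exts-[/0] σ t a =
  trans ([/0]-as-sub (sub (exts σ) t) a) (trans (sub-sub (a • var) (exts σ) t) (sub-cong pointwise t))
  where
  pointwise : sub (a • var) ∘ exts σ ≗ a • σ
  pointwise zero    = refl
  pointwise (suc i) = sub-ren-id (λ _ → refl) (σ i)

sub-[/0] : ∀ σ t u → sub σ (t [ u /0]) ≡ sub (exts σ) t [ sub σ u /0]
sub-[/0] σ t u =
  trans (cong (sub σ) ([/0]-as-sub t u))
  (trans (sub-sub σ (u • var) t)
  (trans (sub-cong pointwise t) (sym (sub-exts-[/0] σ t (sub σ u)))))
  where
  pointwise : sub σ ∘ (u • var) ≗ sub σ u • σ
  pointwise zero    = refl
  pointwise (suc i) = refl

subF : (ℕ → Tm) → Frame → Frame
subF σ (app[-] v)    = app[-] (sub σ v)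
subF σ π₁[-]         = π₁[-]
subF σ π₂[-]         = π₂[-]
subF σ (case[-] t u) = case[-] (sub (exts σ) t) (sub (exts σ) u)
subF σ abort[-]      = abort[-]
subF σ open[-]       = open[-]

sub-exts-plug-wkF : ∀ σ F t → sub (exts σ) (plug (wkF F) t) ≡ plug (wkF (subF σ F)) (sub (exts σ) t)
sub-exts-plug-wkF σ (app[-] v)    t = cong (sub (exts σ) t ·_) (sub-ren-commute (λ _ → refl) v)
sub-exts-plug-wkF σ π₁[-]         t = refl
sub-exts-plug-wkF σ π₂[-]         t = refl
sub-exts-plug-wkF σ (case[-] x y) t =
  cong₂ (case (sub (exts σ) t)) (sub-ren-commute pointwise x) (sub-ren-commute pointwise y)
  where
  pointwise : exts (exts σ) ∘ ext suc ≗ ren (ext suc) ∘ exts σ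
  pointwise zero    = refl
  pointwise (suc i) = trans (ren-ren suc suc (σ i)) (sym (ren-ren (ext suc) suc (σ i)))
sub-exts-plug-wkF σ abort[-]      t = refl
sub-exts-plug-wkF σ open[-]       t = refl

[/0]-plug-wkF : ∀ F t a → plug (wkF F) t [ a /0] ≡ plug F (t [ a /0])
[/0]-plug-wkF (app[-] v)    t a = cong (t [ a /0] ·_) (sub-ren-id (λ _ → refl) v)
[/0]-plug-wkF π₁[-]         t a = refl
[/0]-plug-wkF π₂[-]         t a = refl
[/0]-plug-wkF (case[-] x y) t a = cong₂ (case (t [ a /0]))
  (sub-ren-id (λ { zero → refl ; (suc i) → refl }) x) (sub-ren-id (λ { zero → refl ; (suc i) → refl }) y)
[/0]-plug-wkF abort[-]      t a = refl
[/0]-plug-wkF open[-]       t a = refl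

-- The relation ↦ with its commuting conversions split by frame, so that the steps out of a
-- given term can be inverted by pattern matching.
infix 4 _▸_⟶ₕ_ _⟶_

data _▸_⟶ₕ_ : Frame → Tm → Tm → Set where
  β⇒  : ∀ {t u} → app[-] u ▸ lam t ⟶ₕ t [ u /0]
  β⊗₁ : ∀ {t u} → π₁[-] ▸ ⟨ t , u ⟩ ⟶ₕ t
  β⊗₂ : ∀ {t u} → π₂[-] ▸ ⟨ t , u ⟩ ⟶ₕ u
  β⊕₁ : ∀ {s t u} → case[-] t u ▸ inl s ⟶ₕ t [ s /0]
  β⊕₂ : ∀ {s t u} → case[-] t u ▸ inr s ⟶ₕ u [ s /0]
  β□  : ∀ {t} → open[-] ▸ shut t ⟶ₕ t
  κ   : ∀ {F s t u} → F ▸ case s t u ⟶ₕ case s (plug (wkF F) t) (plug (wkF F) u)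
  α   : ∀ {F t} → F ▸ abort t ⟶ₕ abort t

data _⟶_ : Tm → Tm → Set where
  app-head   : ∀ {t t' u} → app[-] u ▸ t ⟶ₕ t' → t · u ⟶ t'
  π₁-head    : ∀ {t t'} → π₁[-] ▸ t ⟶ₕ t' → π₁ t ⟶ t'
  π₂-head    : ∀ {t t'} → π₂[-] ▸ t ⟶ₕ t' → π₂ t ⟶ t'
  case-head  : ∀ {s s' t u} → case[-] t u ▸ s ⟶ₕ s' → case s t u ⟶ s'
  abort-head : ∀ {t t'} → abort[-] ▸ t ⟶ₕ t' → abort t ⟶ t'
  open-head  : ∀ {t t'} → open[-] ▸ t ⟶ₕ t' → open' t ⟶ t'
  ξpair₁ : ∀ {t t' u} → t ⟶ t' → ⟨ t , u ⟩ ⟶ ⟨ t' , u ⟩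
  ξpair₂ : ∀ {t u u'} → u ⟶ u' → ⟨ t , u ⟩ ⟶ ⟨ t , u' ⟩
  ξπ₁    : ∀ {t t'} → t ⟶ t' → π₁ t ⟶ π₁ t'
  ξπ₂    : ∀ {t t'} → t ⟶ t' → π₂ t ⟶ π₂ t'
  ξlam   : ∀ {t t'} → t ⟶ t' → lam t ⟶ lam t'
  ξapp₁  : ∀ {t t' u} → t ⟶ t' → t · u ⟶ t' · u
  ξapp₂  : ∀ {t u u'} → u ⟶ u' → t · u ⟶ t · u'
  ξinl   : ∀ {t t'} → t ⟶ t' → inl t ⟶ inl t'
  ξinr   : ∀ {t t'} → t ⟶ t' → inr t ⟶ inr t'
  ξcase₁ : ∀ {s s' t u} → s ⟶ s' → case s t u ⟶ case s' t u
  ξcase₂ : ∀ {s t t' u} → t ⟶ t' → case s t u ⟶ case s t' u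
  ξcase₃ : ∀ {s t u u'} → u ⟶ u' → case s t u ⟶ case s t u'
  ξabort : ∀ {t t'} → t ⟶ t' → abort t ⟶ abort t'
  ξshut  : ∀ {t t'} → t ⟶ t' → shut t ⟶ shut t'
  ξopen  : ∀ {t t'} → t ⟶ t' → open' t ⟶ open' t'

head : ∀ F {t t'} → F ▸ t ⟶ₕ t' → plug F t ⟶ t'
head (app[-] u)    = app-head
head π₁[-]         = π₁-head
head π₂[-]         = π₂-head
head (case[-] t u) = case-head
head abort[-]      = abort-head
head open[-]       = open-head

↦⇒⟶ : ∀ {t t'} → t ↦ t' → t ⟶ t'
↦⇒⟶ β⇒              = app-head β⇒
↦⇒⟶ β⊗₁             = π₁-head β⊗₁
↦⇒⟶ β⊗₂             = π₂-head β⊗₂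
↦⇒⟶ β⊕₁             = case-head β⊕₁
↦⇒⟶ β⊕₂             = case-head β⊕₂
↦⇒⟶ β□              = open-head β□
↦⇒⟶ (κcase {E})     = head E κ
↦⇒⟶ (κabort {E})    = head E α
↦⇒⟶ (ξpair₁ r)      = ξpair₁ (↦⇒⟶ r)
↦⇒⟶ (ξpair₂ r)      = ξpair₂ (↦⇒⟶ r)
↦⇒⟶ (ξπ₁ r)         = ξπ₁ (↦⇒⟶ r)
↦⇒⟶ (ξπ₂ r)         = ξπ₂ (↦⇒⟶ r)
↦⇒⟶ (ξlam r)        = ξlam (↦⇒⟶ r)
↦⇒⟶ (ξapp₁ r)       = ξapp₁ (↦⇒⟶ r)
↦⇒⟶ (ξapp₂ r)       = ξapp₂ (↦⇒⟶ r)
↦⇒⟶ (ξinl r)        = ξinl (↦⇒⟶ r)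
↦⇒⟶ (ξinr r)        = ξinr (↦⇒⟶ r)
↦⇒⟶ (ξcase₁ r)      = ξcase₁ (↦⇒⟶ r)
↦⇒⟶ (ξcase₂ r)      = ξcase₂ (↦⇒⟶ r)
↦⇒⟶ (ξcase₃ r)      = ξcase₃ (↦⇒⟶ r)
↦⇒⟶ (ξabort r)      = ξabort (↦⇒⟶ r)
↦⇒⟶ (ξshut r)       = ξshut (↦⇒⟶ r)
↦⇒⟶ (ξopen r)       = ξopen (↦⇒⟶ r)

sub-⟶ₕ : ∀ σ {F t t'} → F ▸ t ⟶ₕ t' → subF σ F ▸ sub σ t ⟶ₕ sub σ t'
sub-⟶ₕ σ (β⇒ {t} {u})     = subst (app[-] (sub σ u) ▸ lam (sub (exts σ) t) ⟶ₕ_) (sym (sub-[/0] σ t u)) β⇒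
sub-⟶ₕ σ β⊗₁              = β⊗₁
sub-⟶ₕ σ β⊗₂              = β⊗₂
sub-⟶ₕ σ (β⊕₁ {s} {t} {u}) = subst (subF σ (case[-] t u) ▸ inl (sub σ s) ⟶ₕ_) (sym (sub-[/0] σ t s)) β⊕₁
sub-⟶ₕ σ (β⊕₂ {s} {t} {u}) = subst (subF σ (case[-] t u) ▸ inr (sub σ s) ⟶ₕ_) (sym (sub-[/0] σ u s)) β⊕₂
sub-⟶ₕ σ β□               = β□
sub-⟶ₕ σ (κ {F} {s} {t} {u}) =
  subst₂ (λ t' u' → subF σ F ▸ sub σ (case s t u) ⟶ₕ case (sub σ s) t' u')
    (sym (sub-exts-plug-wkF σ F t)) (sym (sub-exts-plug-wkF σ F u)) κ
sub-⟶ₕ σ α                = α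

sub-⟶ : ∀ σ {t t'} → t ⟶ t' → sub σ t ⟶ sub σ t'
sub-⟶ σ (app-head h)   = app-head (sub-⟶ₕ σ h)
sub-⟶ σ (π₁-head h)    = π₁-head (sub-⟶ₕ σ h)
sub-⟶ σ (π₂-head h)    = π₂-head (sub-⟶ₕ σ h)
sub-⟶ σ (case-head h)  = case-head (sub-⟶ₕ σ h)
sub-⟶ σ (abort-head h) = abort-head (sub-⟶ₕ σ h)
sub-⟶ σ (open-head h)  = open-head (sub-⟶ₕ σ h)
sub-⟶ σ (ξpair₁ r)     = ξpair₁ (sub-⟶ σ r)
sub-⟶ σ (ξpair₂ r)     = ξpair₂ (sub-⟶ σ r)
sub-⟶ σ (ξπ₁ r)        = ξπ₁ (sub-⟶ σ r)
sub-⟶ σ (ξπ₂ r)        = ξπ₂ (sub-⟶ σ r)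
sub-⟶ σ (ξlam r)       = ξlam (sub-⟶ (exts σ) r)
sub-⟶ σ (ξapp₁ r)      = ξapp₁ (sub-⟶ σ r)
sub-⟶ σ (ξapp₂ r)      = ξapp₂ (sub-⟶ σ r)
sub-⟶ σ (ξinl r)       = ξinl (sub-⟶ σ r)
sub-⟶ σ (ξinr r)       = ξinr (sub-⟶ σ r)
sub-⟶ σ (ξcase₁ r)     = ξcase₁ (sub-⟶ σ r)
sub-⟶ σ (ξcase₂ r)     = ξcase₂ (sub-⟶ (exts σ) r)
sub-⟶ σ (ξcase₃ r)     = ξcase₃ (sub-⟶ (exts σ) r)
sub-⟶ σ (ξabort r)     = ξabort (sub-⟶ σ r)
sub-⟶ σ (ξshut r)      = ξshut (sub-⟶ σ r)
sub-⟶ σ (ξopen r)      = ξopen (sub-⟶ σ r)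

[/0]-⟶ : ∀ {t t'} u → t ⟶ t' → t [ u /0] ⟶ t' [ u /0]
[/0]-⟶ u = sub-⟶ _

SN : Tm → Set
SN = Acc (flip _⟶_)

Stack : Set
Stack = List Frame

plugs : Stack → Tm → Tm
plugs []      t = t
plugs (F ∷ K) t = plugs K (plug F t)

plug-⟶ : ∀ F {t t'} → t ⟶ t' → plug F t ⟶ plug F t'
plug-⟶ (app[-] v)    = ξapp₁
plug-⟶ π₁[-]         = ξπ₁
plug-⟶ π₂[-]         = ξπ₂
plug-⟶ (case[-] t u) = ξcase₁
plug-⟶ abort[-]      = ξabort
plug-⟶ open[-]       = ξopen

plugs-⟶ : ∀ K {t t'} → t ⟶ t' → plugs K t ⟶ plugs K t'
plugs-⟶ []      r = r
plugs-⟶ (F ∷ K) r = plugs-⟶ K (plug-⟶ F r)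

SN-plugs⁻ : ∀ K {t} → SN (plugs K t) → SN t
SN-plugs⁻ K (acc h) = acc (λ r → SN-plugs⁻ K (h (plugs-⟶ K r)))

infix 4 _⟶ᶠ_ _⟶ˢ_

data _⟶ᶠ_ : Frame → Frame → Set where
  app   : ∀ {v v'} → v ⟶ v' → app[-] v ⟶ᶠ app[-] v'
  case₁ : ∀ {t t' u} → t ⟶ t' → case[-] t u ⟶ᶠ case[-] t' u
  case₂ : ∀ {t u u'} → u ⟶ u' → case[-] t u ⟶ᶠ case[-] t u'

plug-⟶ᶠ : ∀ {F F' t} → F ⟶ᶠ F' → plug F t ⟶ plug F' t
plug-⟶ᶠ (app r)   = ξapp₂ r
plug-⟶ᶠ (case₁ r) = ξcase₂ r
plug-⟶ᶠ (case₂ r) = ξcase₃ r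

data _⟶ˢ_ : Stack → Stack → Set where
  here  : ∀ {F F' K} → F ⟶ᶠ F' → F ∷ K ⟶ˢ F' ∷ K
  there : ∀ {F K K'} → K ⟶ˢ K' → F ∷ K ⟶ˢ F ∷ K'
  κ     : ∀ {t u G K} → case[-] t u ∷ G ∷ K ⟶ˢ case[-] (plug (wkF G) t) (plug (wkF G) u) ∷ K
  α     : ∀ {G K} → abort[-] ∷ G ∷ K ⟶ˢ abort[-] ∷ K

plugs-⟶ˢ : ∀ {K K'} t → K ⟶ˢ K' → plugs K t ⟶ plugs K' t
plugs-⟶ˢ {F ∷ K}     t (here r)  = plugs-⟶ K (plug-⟶ᶠ r)
plugs-⟶ˢ {F ∷ K}     t (there r) = plugs-⟶ˢ (plug F t) r
plugs-⟶ˢ {_ ∷ G ∷ K} t κ         = plugs-⟶ K (head G κ)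
plugs-⟶ˢ {_ ∷ G ∷ K} t α         = plugs-⟶ K (head G α)

length-⟶ˢ : ∀ {K K'} → K ⟶ˢ K' → length K' ≤ length K
length-⟶ˢ (here r)      = ≤-refl
length-⟶ˢ (there r)     = s≤s (length-⟶ˢ r)
length-⟶ˢ {_ ∷ _ ∷ K} κ = s≤s (n≤1+n (length K))
length-⟶ˢ {_ ∷ _ ∷ K} α = s≤s (n≤1+n (length K))

data PlugStep (F : Frame) (X : Tm) : Tm → Set where
  inner : ∀ {X'} → X ⟶ X' → PlugStep F X (plug F X')
  frame : ∀ {F'} → F ⟶ᶠ F' → PlugStep F X (plug F' X)
  redex : ∀ {Z} → F ▸ X ⟶ₕ Z → PlugStep F X Z

classify-plug : ∀ F {X Y} → plug F X ⟶ Y → PlugStep F X Y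
classify-plug (app[-] v)    (app-head h)   = redex h
classify-plug (app[-] v)    (ξapp₁ r)      = inner r
classify-plug (app[-] v)    (ξapp₂ r)      = frame (app r)
classify-plug π₁[-]         (π₁-head h)    = redex h
classify-plug π₁[-]         (ξπ₁ r)        = inner r
classify-plug π₂[-]         (π₂-head h)    = redex h
classify-plug π₂[-]         (ξπ₂ r)        = inner r
classify-plug (case[-] t u) (case-head h)  = redex h
classify-plug (case[-] t u) (ξcase₁ r)     = inner r
classify-plug (case[-] t u) (ξcase₂ r)     = frame (case₁ r)
classify-plug (case[-] t u) (ξcase₃ r)     = frame (case₂ r)
classify-plug abort[-]      (abort-head h) = redex h
classify-plug abort[-]      (ξabort r)     = inner r
classify-plug open[-]       (open-head h)  = redex h
classify-plug open[-]       (ξopen r)      = inner r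

data PlugsStep : Stack → Tm → Tm → Set where
  inner : ∀ {K X X'} → X ⟶ X' → PlugsStep K X (plugs K X')
  stack : ∀ {K K' X} → K ⟶ˢ K' → PlugsStep K X (plugs K' X)
  redex : ∀ {F K X Z} → F ▸ X ⟶ₕ Z → PlugsStep (F ∷ K) X (plugs K Z)

-- An elimination F[X] is never a β-redex, so a head step of the next frame on it is a
-- commuting conversion, which does not depend on X.
frame-redex : ∀ F {G K X Z} → G ▸ plug F X ⟶ₕ Z → PlugsStep (F ∷ G ∷ K) X (plugs K Z)
frame-redex (case[-] t u) κ = stack κ
frame-redex abort[-]      α = stack α

lift-PlugStep : ∀ F K {X Y} → PlugStep F X Y → PlugsStep (F ∷ K) X (plugs K Y)
lift-PlugStep F K (inner r) = inner r
lift-PlugStep F K (frame r) = stack (here r)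
lift-PlugStep F K (redex h) = redex h

classify : ∀ K X {Y} → plugs K X ⟶ Y → PlugsStep K X Y
classify []      X r = inner r
classify (F ∷ K) X r with classify K (plug F X) r
... | inner r' = lift-PlugStep F K (classify-plug F r')
... | stack r' = stack (there r')
classify (F ∷ G ∷ K) X r | redex h = frame-redex F h

data Neutral : Tm → Set where
  var   : ∀ {i} → Neutral (var i)
  app   : ∀ {n v} → Neutral n → Neutral (n · v)
  π₁    : ∀ {n} → Neutral n → Neutral (π₁ n)
  π₂    : ∀ {n} → Neutral n → Neutral (π₂ n)
  open' : ∀ {n} → Neutral n → Neutral (open' n)

Neutral-¬redex : ∀ {F n Z} → Neutral n → ¬ (F ▸ n ⟶ₕ Z)
Neutral-¬redex var        ()
Neutral-¬redex (app ne)   ()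
Neutral-¬redex (π₁ ne)    ()
Neutral-¬redex (π₂ ne)    ()
Neutral-¬redex (open' ne) ()

Neutral-⟶ : ∀ {n n'} → Neutral n → n ⟶ n' → Neutral n'
Neutral-⟶ (app ne)   (app-head h)  = ⊥-elim (Neutral-¬redex ne h)
Neutral-⟶ (app ne)   (ξapp₁ r)     = app (Neutral-⟶ ne r)
Neutral-⟶ (app ne)   (ξapp₂ r)     = app ne
Neutral-⟶ (π₁ ne)    (π₁-head h)   = ⊥-elim (Neutral-¬redex ne h)
Neutral-⟶ (π₁ ne)    (ξπ₁ r)       = π₁ (Neutral-⟶ ne r)
Neutral-⟶ (π₂ ne)    (π₂-head h)   = ⊥-elim (Neutral-¬redex ne h)
Neutral-⟶ (π₂ ne)    (ξπ₂ r)       = π₂ (Neutral-⟶ ne r)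
Neutral-⟶ (open' ne) (open-head h) = ⊥-elim (Neutral-¬redex ne h)
Neutral-⟶ (open' ne) (ξopen r)     = open' (Neutral-⟶ ne r)

SN-var : ∀ {i} → SN (var i)
SN-var = acc (λ ())

-- Any X with K[X] strongly normalising bounds the reductions of the stack K itself.
SN-plugs-neutral : ∀ K {X n} → SN (plugs K X) → SN n → Neutral n → SN (plugs K n)
SN-plugs-neutral K {X} {n} (acc hK) (acc hn) ne = acc (λ r → reduct (classify K n r))
  where
  reduct : ∀ {Y} → PlugsStep K n Y → SN Y
  reduct (inner r)              = SN-plugs-neutral K (acc hK) (hn r) (Neutral-⟶ ne r)
  reduct (stack {K' = K'} r)    = SN-plugs-neutral K' (hK (plugs-⟶ˢ X r)) (acc hn) ne
  reduct (redex h)              = ⊥-elim (Neutral-¬redex ne h)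

SNᶠ : Frame → Set
SNᶠ = Acc (flip _⟶ᶠ_)

SNᶠ-app : ∀ {v} → SN v → SNᶠ (app[-] v)
SNᶠ-app (acc h) = acc (λ { (app r) → SNᶠ-app (h r) })

SN-plug-neutral : ∀ F {n} → SNᶠ F → SN n → Neutral n → SN (plug F n)
SN-plug-neutral F {n} (acc hF) (acc hn) ne = acc (λ r → reduct (classify-plug F r))
  where
  reduct : ∀ {Y} → PlugStep F n Y → SN Y
  reduct (inner r)           = SN-plug-neutral F (acc hF) (hn r) (Neutral-⟶ ne r)
  reduct (frame {F' = F'} r) = SN-plug-neutral F' (hF r) (acc hn) ne
  reduct (redex h)           = ⊥-elim (Neutral-¬redex ne h)

SN-inl : ∀ {t} → SN t → SN (inl t)
SN-inl (acc h) = acc (λ { (ξinl r) → SN-inl (h r) })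

SN-inr : ∀ {t} → SN t → SN (inr t)
SN-inr (acc h) = acc (λ { (ξinr r) → SN-inr (h r) })

data ⊗-Stack (P Q : Stack → Set) : Stack → Set where
  π₁∷_ : ∀ {K} → P K → ⊗-Stack P Q (π₁[-] ∷ K)
  π₂∷_ : ∀ {K} → Q K → ⊗-Stack P Q (π₂[-] ∷ K)

data ⇒-Stack (P : Tm → Set) (Q : Stack → Set) : Stack → Set where
  _·∷_ : ∀ {v K} → P v → Q K → ⇒-Stack P Q (app[-] v ∷ K)

data □-Stack (P : Stack → Set) : Stack → Set where
  open∷_ : ∀ {K} → P K → □-Stack P (open[-] ∷ K)

⟦_⟧ : Ty → Tm → Set
⟦_⟧ˢ : Ty → Stack → Set

⟦ A ⟧ t = ∀ K → ⟦ A ⟧ˢ K → SN (plugs K t)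

⟦ atom _ ⟧ˢ K = K ≡ []
⟦ 𝟙 ⟧ˢ K      = K ≡ []
⟦ A ⊗ B ⟧ˢ    = ⊗-Stack ⟦ A ⟧ˢ ⟦ B ⟧ˢ
⟦ A ⇒ B ⟧ˢ    = ⇒-Stack ⟦ A ⟧ ⟦ B ⟧ˢ
⟦ 𝟘 ⟧ˢ K      = SN (plugs K (var 0))
⟦ A ⊕ B ⟧ˢ K  = (∀ a → ⟦ A ⟧ a → SN (plugs K (inl a))) × (∀ b → ⟦ B ⟧ b → SN (plugs K (inr b)))
⟦ □ A ⟧ˢ      = □-Stack ⟦ A ⟧ˢ

⟦⟧-⟶ : ∀ {A t t'} → ⟦ A ⟧ t → t ⟶ t' → ⟦ A ⟧ t'
⟦⟧-⟶ rt r K k = acc-inverse (rt K k) (plugs-⟶ K r)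

neutral-⟦⟧ : ∀ A {n} → Neutral n → SN n → ⟦ A ⟧ n
⟦⟧ˢ-inhabited : ∀ A → Σ Stack ⟦ A ⟧ˢ

⟦⟧⇒SN : ∀ A {t} → ⟦ A ⟧ t → SN t
⟦⟧⇒SN A rt with ⟦⟧ˢ-inhabited A
... | K , k = SN-plugs⁻ K (rt K k)

⟦var⟧ : ∀ A {i} → ⟦ A ⟧ (var i)
⟦var⟧ A = neutral-⟦⟧ A var SN-var

neutral-⟦⟧ (atom _) ne s .[] refl       = s
neutral-⟦⟧ 𝟙        ne s .[] refl       = s
neutral-⟦⟧ (A ⊗ B)  ne s _ (π₁∷ k)      = neutral-⟦⟧ A (π₁ ne) (SN-plug-neutral π₁[-] (acc λ ()) s ne) _ k
neutral-⟦⟧ (A ⊗ B)  ne s _ (π₂∷ k)      = neutral-⟦⟧ B (π₂ ne) (SN-plug-neutral π₂[-] (acc λ ()) s ne) _ k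
neutral-⟦⟧ (A ⇒ B)  ne s _ (rv ·∷ k)    =
  neutral-⟦⟧ B (app ne) (SN-plug-neutral (app[-] _) (SNᶠ-app (⟦⟧⇒SN A rv)) s ne) _ k
neutral-⟦⟧ 𝟘        ne s K k            = SN-plugs-neutral K k s ne
neutral-⟦⟧ (A ⊕ B)  ne s K (kl , _)     = SN-plugs-neutral K (kl (var 0) (⟦var⟧ A)) s ne
neutral-⟦⟧ (□ A)    ne s _ (open∷ k)    = neutral-⟦⟧ A (open' ne) (SN-plug-neutral open[-] (acc λ ()) s ne) _ k

⟦⟧ˢ-inhabited (atom _) = [] , refl
⟦⟧ˢ-inhabited 𝟙        = [] , refl
⟦⟧ˢ-inhabited (A ⊗ B)  = _ , π₁∷ proj₂ (⟦⟧ˢ-inhabited A)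
⟦⟧ˢ-inhabited (A ⇒ B)  = _ , ⟦var⟧ A {0} ·∷ proj₂ (⟦⟧ˢ-inhabited B)
⟦⟧ˢ-inhabited 𝟘        = [] , SN-var
⟦⟧ˢ-inhabited (A ⊕ B)  = [] , (λ a ra → SN-inl (⟦⟧⇒SN A ra)) , (λ b rb → SN-inr (⟦⟧⇒SN B rb))
⟦⟧ˢ-inhabited (□ A)    = _ , open∷ proj₂ (⟦⟧ˢ-inhabited A)

-- The last hypothesis is an instance of the previous one, kept separate as a termination measure.
SN-β : ∀ {A} K {t v} → ⟦ A ⟧ v → SN v → (∀ a → ⟦ A ⟧ a → SN (plugs K (t [ a /0]))) →
       SN (plugs K (t [ v /0])) → SN (plugs K (lam t · v))
SN-β {A} K {t} {v} rv sv body st = acc (λ r → reduct sv st (classify K _ r))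
  where
  reduct : ∀ {Y} → SN v → SN (plugs K (t [ v /0])) → PlugsStep K (lam t · v) Y → SN Y
  reduct sv       st      (inner (app-head β⇒))    = st
  reduct sv       (acc h) (inner (ξapp₁ (ξlam r))) =
    SN-β K rv sv (λ a ra → acc-inverse (body a ra) (plugs-⟶ K ([/0]-⟶ a r))) (h (plugs-⟶ K ([/0]-⟶ v r)))
  reduct (acc hv) st      (inner (ξapp₂ r))        = SN-β K (⟦⟧-⟶ {A} rv r) (hv r) body (body _ (⟦⟧-⟶ {A} rv r))
  reduct sv       (acc h) (stack {K' = K'} r)      =
    SN-β K' rv sv (λ a ra → acc-inverse (body a ra) (plugs-⟶ˢ _ r)) (h (plugs-⟶ˢ _ r))

SN-π₁ : ∀ K {t u} → SN (plugs K t) → SN u → SN (plugs K (π₁ ⟨ t , u ⟩))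
SN-π₁ K {t} {u} st su = acc (λ r → reduct st su (classify K _ r))
  where
  reduct : ∀ {Y} → SN (plugs K t) → SN u → PlugsStep K (π₁ ⟨ t , u ⟩) Y → SN Y
  reduct st      su      (inner (π₁-head β⊗₁))    = st
  reduct (acc h) su      (inner (ξπ₁ (ξpair₁ r))) = SN-π₁ K (h (plugs-⟶ K r)) su
  reduct st      (acc h) (inner (ξπ₁ (ξpair₂ r))) = SN-π₁ K st (h r)
  reduct (acc h) su      (stack {K' = K'} r)      = SN-π₁ K' (h (plugs-⟶ˢ _ r)) su

SN-π₂ : ∀ K {t u} → SN (plugs K u) → SN t → SN (plugs K (π₂ ⟨ t , u ⟩))
SN-π₂ K {t} {u} su st = acc (λ r → reduct su st (classify K _ r))
  where
  reduct : ∀ {Y} → SN (plugs K u) → SN t → PlugsStep K (π₂ ⟨ t , u ⟩) Y → SN Y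
  reduct su      st      (inner (π₂-head β⊗₂))    = su
  reduct su      (acc h) (inner (ξπ₂ (ξpair₁ r))) = SN-π₂ K su (h r)
  reduct (acc h) st      (inner (ξπ₂ (ξpair₂ r))) = SN-π₂ K (h (plugs-⟶ K r)) st
  reduct (acc h) st      (stack {K' = K'} r)      = SN-π₂ K' (h (plugs-⟶ˢ _ r)) st

SN-β□ : ∀ K {t} → SN (plugs K t) → SN (plugs K (open' (shut t)))
SN-β□ K {t} st = acc (λ r → reduct st (classify K _ r))
  where
  reduct : ∀ {Y} → SN (plugs K t) → PlugsStep K (open' (shut t)) Y → SN Y
  reduct st      (inner (open-head β□))    = st
  reduct (acc h) (inner (ξopen (ξshut r))) = SN-β□ K (h (plugs-⟶ K r))
  reduct (acc h) (stack {K' = K'} r)       = SN-β□ K' (h (plugs-⟶ˢ _ r))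

SN-abort : ∀ n K → length K ≤ n → SN (plugs K (var 0)) → SN (plugs K (abort (var 0)))
SN-abort n K l s = acc (λ r → reduct n l s (classify K _ r))
  where
  reduct : ∀ n {Y} → length K ≤ n → SN (plugs K (var 0)) → PlugsStep K (abort (var 0)) Y → SN Y
  reduct n       l       s       (inner (abort-head ()))
  reduct n       l       s       (inner (ξabort ()))
  reduct n       l       (acc h) (stack {K' = K'} r) = SN-abort n K' (≤-trans (length-⟶ˢ r) l) (h (plugs-⟶ˢ _ r))
  reduct (suc n) (s≤s l) s       (redex {K = K'} α)  = SN-abort n K' l (SN-plugs-neutral K' s SN-var var)

data Injection (A B : Ty) : Tm → Set where
  inl : ∀ {a} → ⟦ A ⟧ a → Injection A B (inl a)
  inr : ∀ {b} → ⟦ B ⟧ b → Injection A B (inr b)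

Injection-⟶ : ∀ {A B x x'} → Injection A B x → x ⟶ x' → Injection A B x'
Injection-⟶ {A} (inl ra) (ξinl r) = inl (⟦⟧-⟶ {A} ra r)
Injection-⟶ {B = B} (inr rb) (ξinr r) = inr (⟦⟧-⟶ {B} rb r)

Injection⇒SN : ∀ {A B x} → Injection A B x → SN x
Injection⇒SN {A} (inl ra) = SN-inl (⟦⟧⇒SN A ra)
Injection⇒SN {B = B} (inr rb) = SN-inr (⟦⟧⇒SN B rb)

SN-plugs-wkF : ∀ F K t a → SN (plugs (F ∷ K) (t [ a /0])) → SN (plugs K (plug (wkF F) t [ a /0]))
SN-plugs-wkF F K t a = subst (λ z → SN (plugs K z)) (sym ([/0]-plug-wkF F t a))

-- The branches instantiated with var 0 are the termination measures for steps inside them.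
SN-case : ∀ {A B} n K {x t u} → length K ≤ n → Injection A B x →
          (∀ a → ⟦ A ⟧ a → SN (plugs K (t [ a /0]))) → (∀ b → ⟦ B ⟧ b → SN (plugs K (u [ b /0]))) →
          SN x → SN (plugs K (t [ var 0 /0])) → SN (plugs K (u [ var 0 /0])) → SN (plugs K (case x t u))
SN-case {A} {B} n K {x} {t} {u} l ix bt bu sx st su = acc (λ r → reduct n l ix sx st su (classify K _ r))
  where
  reduct : ∀ n {Y} → length K ≤ n → Injection A B x → SN x → SN (plugs K (t [ var 0 /0])) →
           SN (plugs K (u [ var 0 /0])) → PlugsStep K (case x t u) Y → SN Y
  reduct n l (inl ra) sx st su (inner (case-head β⊕₁)) = bt _ ra
  reduct n l (inr rb) sx st su (inner (case-head β⊕₂)) = bu _ rb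
  reduct n l ix (acc h) st su (inner (ξcase₁ r)) = SN-case n K l (Injection-⟶ ix r) bt bu (h r) st su
  reduct n l ix sx (acc h) su (inner (ξcase₂ r)) =
    SN-case n K l ix (λ a ra → acc-inverse (bt a ra) (plugs-⟶ K ([/0]-⟶ a r))) bu sx (h (plugs-⟶ K ([/0]-⟶ _ r))) su
  reduct n l ix sx st (acc h) (inner (ξcase₃ r)) =
    SN-case n K l ix bt (λ b rb → acc-inverse (bu b rb) (plugs-⟶ K ([/0]-⟶ b r))) sx st (h (plugs-⟶ K ([/0]-⟶ _ r)))
  reduct n l ix sx (acc h) su (stack {K' = K'} r) =
    SN-case n K' (≤-trans (length-⟶ˢ r) l) ix (λ a ra → acc-inverse (bt a ra) (plugs-⟶ˢ _ r))
      (λ b rb → acc-inverse (bu b rb) (plugs-⟶ˢ _ r)) sx (h (plugs-⟶ˢ _ r)) (acc-inverse su (plugs-⟶ˢ _ r))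
  reduct (suc n) (s≤s l) ix sx st su (redex {F} {K'} κ) =
    SN-case n K' l ix (λ a ra → SN-plugs-wkF F K' t a (bt a ra)) (λ b rb → SN-plugs-wkF F K' u b (bu b rb))
      sx (SN-plugs-wkF F K' t _ st) (SN-plugs-wkF F K' u _ su)

⟦⟧-lam : ∀ {A B t} → (∀ a → ⟦ A ⟧ a → ⟦ B ⟧ (t [ a /0])) → ⟦ A ⇒ B ⟧ (lam t)
⟦⟧-lam {A} ht (app[-] v ∷ K) (rv ·∷ k) = SN-β {A} K rv (⟦⟧⇒SN A rv) (λ a ra → ht a ra K k) (ht v rv K k)

⟦⟧-pair : ∀ {A B t u} → ⟦ A ⟧ t → ⟦ B ⟧ u → ⟦ A ⊗ B ⟧ ⟨ t , u ⟩
⟦⟧-pair {B = B} rt ru (π₁[-] ∷ K) (π₁∷ k) = SN-π₁ K (rt K k) (⟦⟧⇒SN B ru)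
⟦⟧-pair {A}     rt ru (π₂[-] ∷ K) (π₂∷ k) = SN-π₂ K (ru K k) (⟦⟧⇒SN A rt)

⟦⟧-shut : ∀ {A t} → ⟦ A ⟧ t → ⟦ □ A ⟧ (shut t)
⟦⟧-shut rt (open[-] ∷ K) (open∷ k) = SN-β□ K (rt K k)

⟦⟧-case : ∀ {A B C s t u} → ⟦ A ⊕ B ⟧ s →
          (∀ a → ⟦ A ⟧ a → ⟦ C ⟧ (t [ a /0])) → (∀ b → ⟦ B ⟧ b → ⟦ C ⟧ (u [ b /0])) → ⟦ C ⟧ (case s t u)
⟦⟧-case {A} {B} {C} {s} {t} {u} rs ht hu K k =
  rs (case[-] t u ∷ K) ((λ a ra → SN-case-of (inl ra)) , (λ b rb → SN-case-of (inr rb)))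
  where
  SN-case-of : ∀ {x} → Injection A B x → SN (plugs K (case x t u))
  SN-case-of ix = SN-case (length K) K ≤-refl ix (λ a ra → ht a ra K k) (λ b rb → hu b rb K k)
    (Injection⇒SN ix) (ht _ (⟦var⟧ A) K k) (hu _ (⟦var⟧ B) K k)

⟦⟧-abort : ∀ {C t} → ⟦ 𝟘 ⟧ t → ⟦ C ⟧ (abort t)
⟦⟧-abort {C} rt K k = rt (abort[-] ∷ K) (SN-abort (length K) K ≤-refl (⟦var⟧ C K k))

-- Locks are invisible to reducibility; indices beyond the context get the junk type 𝟙.
typeOf : Ctx → ℕ → Ty
typeOf ε        _       = 𝟙
typeOf (Γ ,∶ A) zero    = A
typeOf (Γ ,∶ A) (suc i) = typeOf Γ i
typeOf (Γ ,🔒)  i       = typeOf Γ i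

typeOf-var : ∀ Γ Γ' A → typeOf ((Γ ,∶ A) ++ Γ') (nvars Γ') ≡ A
typeOf-var Γ ε         A = refl
typeOf-var Γ (Γ' ,∶ B) A = typeOf-var Γ Γ' A
typeOf-var Γ (Γ' ,🔒)  A = typeOf-var Γ Γ' A

typeOf-wk : ∀ Γ Γ' i → typeOf (Γ ++ Γ') (nvars Γ' + i) ≡ typeOf Γ i
typeOf-wk Γ ε         i = refl
typeOf-wk Γ (Γ' ,∶ B) i = typeOf-wk Γ Γ' i
typeOf-wk Γ (Γ' ,🔒)  i = typeOf-wk Γ Γ' i

mvIdx-suc : ∀ k i → mvIdx (suc k) (suc i) ≡ ext suc (mvIdx k i)
mvIdx-suc k zero with 0 <ᵇ k
... | true  = refl
... | false = refl
mvIdx-suc k (suc i) with suc i <ᵇ k | k <ᵇ suc i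
... | true  | _     = refl
... | false | true  = refl
... | false | false = refl

typeOf-ext-suc : ∀ Δ A B j → typeOf ((Δ ,∶ B) ,∶ A) (ext suc j) ≡ typeOf (Δ ,∶ A) j
typeOf-ext-suc Δ A B zero    = refl
typeOf-ext-suc Δ A B (suc j) = refl

typeOf-,🔒,∶ : ∀ Δ A j → typeOf ((Δ ,🔒) ,∶ A) j ≡ typeOf (Δ ,∶ A) j
typeOf-,🔒,∶ Δ A zero    = refl
typeOf-,🔒,∶ Δ A (suc j) = refl

typeOf-mv : ∀ Γ Γ' A i → typeOf ((Γ ,∶ A) ++ Γ') i ≡ typeOf ((Γ ++ Γ') ,∶ A) (mvIdx (nvars Γ') i)
typeOf-mv Γ ε         A zero    = refl
typeOf-mv Γ ε         A (suc i) = refl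
typeOf-mv Γ (Γ' ,∶ B) A zero    = refl
typeOf-mv Γ (Γ' ,∶ B) A (suc i) = trans (typeOf-mv Γ Γ' A i) (sym (trans
  (cong (typeOf (((Γ ++ Γ') ,∶ B) ,∶ A)) (mvIdx-suc (nvars Γ') i)) (typeOf-ext-suc (Γ ++ Γ') A B (mvIdx (nvars Γ') i))))
typeOf-mv Γ (Γ' ,🔒)  A i       = trans (typeOf-mv Γ Γ' A i) (sym (typeOf-,🔒,∶ (Γ ++ Γ') A (mvIdx (nvars Γ') i)))

infix 4 _⊨_

_⊨_ : (ℕ → Tm) → Ctx → Set
σ ⊨ Γ = ∀ i → ⟦ typeOf Γ i ⟧ (σ i)

⊨-cons : ∀ {σ Γ A a} → σ ⊨ Γ → ⟦ A ⟧ a → (a • σ) ⊨ Γ ,∶ A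
⊨-cons ρ ra zero    = ra
⊨-cons ρ ra (suc i) = ρ i

⊨-drop : ∀ {σ} Γ Γ' → σ ⊨ Γ ++ Γ' → σ ∘ (nvars Γ' +_) ⊨ Γ
⊨-drop {σ} Γ Γ' ρ i = subst (λ T → ⟦ T ⟧ (σ (nvars Γ' + i))) (typeOf-wk Γ Γ' i) (ρ (nvars Γ' + i))

⊨-mv : ∀ {σ} Γ Γ' A → σ ⊨ (Γ ++ Γ') ,∶ A → σ ∘ mvIdx (nvars Γ') ⊨ (Γ ,∶ A) ++ Γ'
⊨-mv {σ} Γ Γ' A ρ i = subst (λ T → ⟦ T ⟧ (σ (mvIdx (nvars Γ') i))) (sym (typeOf-mv Γ Γ' A i)) (ρ _)

fundamental : ∀ {Γ t A} → Γ ⊢ t ∶ A → ∀ {σ} → σ ⊨ Γ → ⟦ A ⟧ (sub σ t)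

fundamental-wkn : ∀ {Γ t A} k → Γ ⊢ t ∶ A → ∀ {σ} → σ ∘ (k +_) ⊨ Γ → ⟦ A ⟧ (sub σ (wkn k t))
fundamental-wkn {t = t} {A} k d {σ} ρ = subst ⟦ A ⟧ (sym (sub-ren σ (k +_) t)) (fundamental d ρ)

fundamental-branch : ∀ {Γ t C} Γ' {A} → (Γ ,∶ A) ++ Γ' ⊢ t ∶ C → ∀ {σ} → σ ⊨ Γ ++ Γ' →
                     ∀ a → ⟦ A ⟧ a → ⟦ C ⟧ (sub (exts σ) (mv (nvars Γ') t) [ a /0])
fundamental-branch {Γ} {t} {C} Γ' {A} d {σ} ρ a ra = subst ⟦ C ⟧
  (sym (trans (sub-exts-[/0] σ (mv (nvars Γ') t) a) (sub-ren (a • σ) (mvIdx (nvars Γ')) t)))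
  (fundamental d (⊨-mv Γ Γ' A (⊨-cons ρ ra)))

fundamental (⊢var {Γ} {Γ'} {A} _) {σ} ρ =
  subst (λ T → ⟦ T ⟧ (σ (nvars Γ'))) (typeOf-var Γ Γ' A) (ρ (nvars Γ'))
fundamental ⊢unit       ρ .[] refl   = acc (λ ())
fundamental (⊢pair d e) ρ            = ⟦⟧-pair (fundamental d ρ) (fundamental e ρ)
fundamental (⊢π₁ d)     ρ K k        = fundamental d ρ (π₁[-] ∷ K) (π₁∷ k)
fundamental (⊢π₂ d)     ρ K k        = fundamental d ρ (π₂[-] ∷ K) (π₂∷ k)
fundamental (⊢lam {t = t} {A} {B} d) {σ} ρ =
  ⟦⟧-lam {A} (λ a ra → subst ⟦ B ⟧ (sym (sub-exts-[/0] σ t a)) (fundamental d (⊨-cons ρ ra)))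
fundamental (⊢app d e)  ρ K k        = fundamental d ρ (app[-] _ ∷ K) (fundamental e ρ ·∷ k)
fundamental (⊢inl d)    ρ K (kl , _) = kl _ (fundamental d ρ)
fundamental (⊢inr d)    ρ K (_ , kr) = kr _ (fundamental d ρ)
fundamental (⊢case {Γ} {Γ'} {A = A} {B} ds dt du) ρ = ⟦⟧-case {A} {B}
  (fundamental-wkn (nvars Γ') ds (⊨-drop Γ Γ' ρ)) (fundamental-branch Γ' dt ρ) (fundamental-branch Γ' du ρ)
fundamental (⊢abort {Γ} {Γ'} d) ρ    = ⟦⟧-abort (fundamental-wkn (nvars Γ') d (⊨-drop Γ Γ' ρ))
fundamental (⊢shut d)   ρ            = ⟦⟧-shut (fundamental d ρ)
fundamental (⊢open {Γ} {Γ'} _ d) ρ K k =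
  fundamental-wkn (nvars Γ') d (⊨-drop (Γ ,🔒) Γ' ρ) (open[-] ∷ K) (open∷ k)

typed⇒SN : ∀ {Γ t A} → Γ ⊢ t ∶ A → SN t
typed⇒SN {Γ} {t} {A} d = ⟦⟧⇒SN A (subst ⟦ A ⟧ (sub-var t) (fundamental d (λ i → ⟦var⟧ (typeOf Γ i))))

Reduct : Tm → Set
Reduct t = Σ Tm (t ⟶_)

infix 4 _∈ᴿ_

_∈ᴿ_ : ∀ {t} → Tm → List (Reduct t) → Set
t' ∈ᴿ rs = Any (λ r → proj₁ r ≡ t') rs

headReducts : ∀ F X → List (Σ Tm (F ▸ X ⟶ₕ_))
headReducts F             (case s t u) = (_ , κ) ∷ []
headReducts F             (abort t)    = (_ , α) ∷ []
headReducts (app[-] u)    (lam t)      = (_ , β⇒) ∷ []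
headReducts π₁[-]         ⟨ t , u ⟩    = (_ , β⊗₁) ∷ []
headReducts π₂[-]         ⟨ t , u ⟩    = (_ , β⊗₂) ∷ []
headReducts (case[-] t u) (inl s)      = (_ , β⊕₁) ∷ []
headReducts (case[-] t u) (inr s)      = (_ , β⊕₂) ∷ []
headReducts open[-]       (shut t)     = (_ , β□) ∷ []
headReducts _             _            = []

headReducts-complete : ∀ {F X Z} → F ▸ X ⟶ₕ Z → Any (λ r → proj₁ r ≡ Z) (headReducts F X)
headReducts-complete β⇒  = here refl
headReducts-complete β⊗₁ = here refl
headReducts-complete β⊗₂ = here refl
headReducts-complete β⊕₁ = here refl
headReducts-complete β⊕₂ = here refl
headReducts-complete β□  = here refl
headReducts-complete κ   = here refl
headReducts-complete α   = here refl

heads : ∀ {F X t} → (∀ {Z} → F ▸ X ⟶ₕ Z → t ⟶ Z) → List (Σ Tm (F ▸ X ⟶ₕ_)) → List (Reduct t)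
heads h = List.map (map₂ h)

congr : ∀ {s t} (f : Tm → Tm) → (∀ {s'} → s ⟶ s' → t ⟶ f s') → List (Reduct s) → List (Reduct t)
congr f ξ = List.map (Product.map f ξ)

headsOf : ∀ t → List (Reduct t)
headsOf (π₁ t)       = heads π₁-head (headReducts π₁[-] t)
headsOf (π₂ t)       = heads π₂-head (headReducts π₂[-] t)
headsOf (t · u)      = heads app-head (headReducts (app[-] u) t)
headsOf (case s t u) = heads case-head (headReducts (case[-] t u) s)
headsOf (abort t)    = heads abort-head (headReducts abort[-] t)
headsOf (open' t)    = heads open-head (headReducts open[-] t)
headsOf _            = []

reducts : ∀ t → List (Reduct t)
innerReducts : ∀ t → List (Reduct t)

reducts t = headsOf t ++ᴸ innerReducts t

innerReducts (var i)      = []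
innerReducts ⟨⟩           = []
innerReducts ⟨ t , u ⟩    = congr (λ x → ⟨ x , u ⟩) ξpair₁ (reducts t) ++ᴸ congr (λ x → ⟨ t , x ⟩) ξpair₂ (reducts u)
innerReducts (π₁ t)       = congr π₁ ξπ₁ (reducts t)
innerReducts (π₂ t)       = congr π₂ ξπ₂ (reducts t)
innerReducts (lam t)      = congr lam ξlam (reducts t)
innerReducts (t · u)      = congr (_· u) ξapp₁ (reducts t) ++ᴸ congr (t ·_) ξapp₂ (reducts u)
innerReducts (inl t)      = congr inl ξinl (reducts t)
innerReducts (inr t)      = congr inr ξinr (reducts t)
innerReducts (case s t u) = congr (λ x → case x t u) ξcase₁ (reducts s)
                            ++ᴸ congr (λ x → case s x u) ξcase₂ (reducts t) ++ᴸ congr (case s t) ξcase₃ (reducts u)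
innerReducts (abort t)    = congr abort ξabort (reducts t)
innerReducts (shut t)     = congr shut ξshut (reducts t)
innerReducts (open' t)    = congr open' ξopen (reducts t)

∈ᴿ-heads : ∀ {F X t Z} (h : ∀ {Z} → F ▸ X ⟶ₕ Z → t ⟶ Z) → F ▸ X ⟶ₕ Z → Z ∈ᴿ heads h (headReducts F X)
∈ᴿ-heads h r = map⁺ (headReducts-complete r)

∈ᴿ-congr : ∀ {s t s'} {rs : List (Reduct s)} f (ξ : ∀ {s'} → s ⟶ s' → t ⟶ f s') →
           s' ∈ᴿ rs → f s' ∈ᴿ congr f ξ rs
∈ᴿ-congr f ξ p = map⁺ (Any.map (cong f) p)

∈ᴿ-inner : ∀ t {t'} → t' ∈ᴿ innerReducts t → t' ∈ᴿ reducts t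
∈ᴿ-inner t = ++⁺ʳ (headsOf t)

reducts-complete : ∀ {t t'} → t ⟶ t' → t' ∈ᴿ reducts t
reducts-complete (app-head h)   = ++⁺ˡ (∈ᴿ-heads app-head h)
reducts-complete (π₁-head h)    = ++⁺ˡ (∈ᴿ-heads π₁-head h)
reducts-complete (π₂-head h)    = ++⁺ˡ (∈ᴿ-heads π₂-head h)
reducts-complete (case-head h)  = ++⁺ˡ (∈ᴿ-heads case-head h)
reducts-complete (abort-head h) = ++⁺ˡ (∈ᴿ-heads abort-head h)
reducts-complete (open-head h)  = ++⁺ˡ (∈ᴿ-heads open-head h)
reducts-complete (ξpair₁ r)     = ++⁺ˡ (∈ᴿ-congr _ ξpair₁ (reducts-complete r))
reducts-complete (ξpair₂ {t} {u} r) =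
  ++⁺ʳ (congr (λ x → ⟨ x , u ⟩) ξpair₁ (reducts t)) (∈ᴿ-congr _ ξpair₂ (reducts-complete r))
reducts-complete (ξπ₁ {t} r)    = ∈ᴿ-inner (π₁ t) (∈ᴿ-congr _ ξπ₁ (reducts-complete r))
reducts-complete (ξπ₂ {t} r)    = ∈ᴿ-inner (π₂ t) (∈ᴿ-congr _ ξπ₂ (reducts-complete r))
reducts-complete (ξlam r)       = ∈ᴿ-congr _ ξlam (reducts-complete r)
reducts-complete (ξapp₁ {t} {u = u} r) = ∈ᴿ-inner (t · u) (++⁺ˡ (∈ᴿ-congr _ ξapp₁ (reducts-complete r)))
reducts-complete (ξapp₂ {t} {u} r) =
  ∈ᴿ-inner (t · u) (++⁺ʳ (congr (_· u) ξapp₁ (reducts t)) (∈ᴿ-congr _ ξapp₂ (reducts-complete r)))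
reducts-complete (ξinl r)       = ∈ᴿ-congr _ ξinl (reducts-complete r)
reducts-complete (ξinr r)       = ∈ᴿ-congr _ ξinr (reducts-complete r)
reducts-complete (ξcase₁ {s} {t = t} {u} r) =
  ∈ᴿ-inner (case s t u) (++⁺ˡ (∈ᴿ-congr _ ξcase₁ (reducts-complete r)))
reducts-complete (ξcase₂ {s} {t} {u = u} r) =
  ∈ᴿ-inner (case s t u) (++⁺ʳ (congr (λ x → case x t u) ξcase₁ (reducts s))
    (++⁺ˡ (∈ᴿ-congr _ ξcase₂ (reducts-complete r))))
reducts-complete (ξcase₃ {s} {t} {u} r) =
  ∈ᴿ-inner (case s t u) (++⁺ʳ (congr (λ x → case x t u) ξcase₁ (reducts s))
    (++⁺ʳ (congr (λ x → case s x u) ξcase₂ (reducts t)) (∈ᴿ-congr _ ξcase₃ (reducts-complete r))))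
reducts-complete (ξabort {t} r) = ∈ᴿ-inner (abort t) (∈ᴿ-congr _ ξabort (reducts-complete r))
reducts-complete (ξshut r)      = ∈ᴿ-congr _ ξshut (reducts-complete r)
reducts-complete (ξopen {t} r)  = ∈ᴿ-inner (open' t) (∈ᴿ-congr _ ξopen (reducts-complete r))

bound : ∀ {t} → SN t → ℕ
bound {t} (acc h) = max 0 (List.map (λ r → suc (bound (h (proj₂ r)))) (reducts t))

bound-sound : ∀ {m t} (s : SN t) → RedSeq m t → m ≤ bound s
bound-sound s       done       = z≤n
bound-sound (acc h) (step r q) =
  v≤max⁺ 0 _ (inj₂ (map⁺ (Any.map (λ { {_ , r'} refl → s≤s (bound-sound (h r') q) }) (reducts-complete (↦⇒⟶ r)))))

SN⇒Normalisable : ∀ {t} → SN t → Normalisable t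
SN⇒Normalisable s = bound s , λ m → bound-sound s

theorem3 : ∀ {Γ t A} → Γ ⊢ t ∶ A → Normalisable t
theorem3 d = SN⇒Normalisable (typed⇒SN d)
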